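{- The operations $\odot$ and $\oplus$ on negotiation sets are not distributive over each other, and the absorption law $A \odot (A \oplus B) = A$ fails in general. Precisely: there exist a non-empty set $X$ and negotiation sets $A,B,C$ on $X$ with $A \oplus (B \odot C) \neq (A \oplus B) \odot (A \oplus C)$; there exist a non-empty set $X$ and negotiation sets $A,B,C$ on $X$ with $A \odot (B \oplus C) \neq (A \odot B) \oplus (A \odot C)$; and there exist a non-empty set $X$ and negotiation sets $A,B$ on $X$ with $A \odot (A \oplus B) \neq A$.
   Context: A negotiation set on a non-empty set $X$ is an ordered pair $A=[A^1,A^2]$ with $A^1 \subseteq A^2 \subseteq X$. For negotiation sets $A,B$: $A \odot B = [A^1 \cap B^1, A^2 \cup B^2]$ and $A \oplus B = [(A^1 \cup B^1) \cap (A^2 \cap B^2), A^2 \cap B^2]$. -}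

module Defs where

open import Level using (0ℓ)
open import Data.Product using (_×_)
open import Relation.Unary using (Pred; _⊆_; _∩_; _∪_; _≐_)
open import Relation.Nullary using (¬_)

-- A negotiation set on X: an ordered pair [A¹ , A²] of subsets with A¹ ⊆ A² ⊆ X.
-- Subsets of X are represented as predicates X → Set.
record NegSet (X : Set) : Set₁ where
  constructor [_,_]⟨_⟩
  field
    lo  : Pred X 0ℓ
    hi  : Pred X 0ℓ
    lo⊆hi : lo ⊆ hi
open NegSet public

_⊙_ : {X : Set} → NegSet X → NegSet X → NegSet X
A ⊙ B = record
  { lo = lo A ∩ lo B
  ; hi = hi A ∪ hi B
  ; lo⊆hi = λ { (a , _) → Data.Sum.inj₁ (lo⊆hi A a) } }
  where import Data.Sum
        open import Data.Product using (_,_)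

_⊕_ : {X : Set} → NegSet X → NegSet X → NegSet X
A ⊕ B = record
  { lo = (lo A ∪ lo B) ∩ (hi A ∩ hi B)
  ; hi = hi A ∩ hi B
  ; lo⊆hi = λ p → proj₂ p }
  where open import Data.Product using (proj₂)

_≋_ : {X : Set} → NegSet X → NegSet X → Set
A ≋ B = (lo A ≐ lo B) × (hi A ≐ hi B)

_≉_ : {X : Set} → NegSet X → NegSet X → Set
A ≉ B = ¬ (A ≋ B)

-- Every counterexample lives on an arbitrary inhabited X and uses only the
-- three constant negotiation sets [X, X], [∅, ∅] and [∅, X]; in each case the
-- two sides already differ in their lower components at a single point.
module Submission where

open import Defs
open import Data.Product using (Σ; _×_; _,_; proj₁; proj₂)
open import Data.Unit using (⊤; tt)
open import Data.Empty using (⊥)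
open import Data.Sum using (inj₁)
open import Relation.Nullary using (¬_)

module _ {X : Set} where

  full : NegSet X
  full = [ (λ _ → ⊤) , (λ _ → ⊤) ]⟨ (λ p → p) ⟩

  empty : NegSet X
  empty = [ (λ _ → ⊥) , (λ _ → ⊥) ]⟨ (λ p → p) ⟩

  unsettled : NegSet X
  unsettled = [ (λ _ → ⊥) , (λ _ → ⊤) ]⟨ (λ ()) ⟩

  ≉-by-loˡ : (A B : NegSet X) (x : X) → lo A x → ¬ lo B x → A ≉ B
  ≉-by-loˡ _ _ x x∈A x∉B A≋B = x∉B (proj₁ (proj₁ A≋B) x∈A)

  ≉-by-loʳ : (A B : NegSet X) (x : X) → ¬ lo A x → lo B x → A ≉ B
  ≉-by-loʳ _ _ x x∉A x∈B A≋B = x∉A (proj₂ (proj₁ A≋B) x∈B)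

  ⊕-not-distribˡ-⊙ : X →
    (full ⊕ (unsettled ⊙ empty)) ≉ ((full ⊕ unsettled) ⊙ (full ⊕ empty))
  ⊕-not-distribˡ-⊙ x =
    ≉-by-loˡ (full ⊕ (unsettled ⊙ empty)) ((full ⊕ unsettled) ⊙ (full ⊕ empty)) x
      (inj₁ tt , tt , inj₁ tt) (λ { (_ , _ , ()) })

  ⊙-not-distribˡ-⊕ : X →
    (full ⊙ (full ⊕ empty)) ≉ ((full ⊙ full) ⊕ (full ⊙ empty))
  ⊙-not-distribˡ-⊕ x =
    ≉-by-loʳ (full ⊙ (full ⊕ empty)) ((full ⊙ full) ⊕ (full ⊙ empty)) x
      (λ { (_ , _ , _ , ()) }) (inj₁ (tt , tt) , inj₁ tt , inj₁ tt)

  ⊙-⊕-not-absorbing : X → (full ⊙ (full ⊕ empty)) ≉ full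
  ⊙-⊕-not-absorbing x =
    ≉-by-loʳ (full ⊙ (full ⊕ empty)) full x (λ { (_ , _ , _ , ()) }) tt

mainTheorem4 :
    (Σ Set λ X → X × Σ (NegSet X) λ A → Σ (NegSet X) λ B → Σ (NegSet X) λ C →
        (A ⊕ (B ⊙ C)) ≉ ((A ⊕ B) ⊙ (A ⊕ C)))
    × (Σ Set λ X → X × Σ (NegSet X) λ A → Σ (NegSet X) λ B → Σ (NegSet X) λ C →
        (A ⊙ (B ⊕ C)) ≉ ((A ⊙ B) ⊕ (A ⊙ C)))
    × (Σ Set λ X → X × Σ (NegSet X) λ A → Σ (NegSet X) λ B →
        (A ⊙ (A ⊕ B)) ≉ A)
mainTheorem4 =
    (⊤ , tt , full , unsettled , empty , ⊕-not-distribˡ-⊙ tt)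
  , (⊤ , tt , full , full , empty , ⊙-not-distribˡ-⊕ tt)
  , (⊤ , tt , full , empty , ⊙-⊕-not-absorbing tt)
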